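{- Let $\sigma$ and $\tau$ be two primitive substitutions on an alphabet $A$ with $d$ letters, both prolongable on $a\in A$, and let $x=\sigma^\omega(a)$, $y=\tau^\omega(a)$. Suppose $x$ and $y$ have a common non-empty prefix $u$ such that (1) $\sigma(w)=\tau(w)$ for all $w\in\mathcal{R}_{x,u}$, and (2) the set $\{V(w): w\in\mathcal{R}_{x,u}\}$ generates $\mathbb{Z}^d$. Then $\tau=\sigma$.
   Context: A substitution is primitive if its incidence matrix (entry $(i,j)$ = number of occurrences of $i$ in $\sigma(j)$) has a power with strictly positive entries; prolongable on $a$ means $\sigma(a)=aw$, $w$ non-empty, $|\sigma^n(a)|\to\infty$, and $\sigma^\omega(a)=\lim_n\sigma^n(a)$. For a uniformly recurrent sequence $x$ and non-empty prefix $u$, a return word to $u$ is a word $x_{[i,j-1]}=x_i\cdots x_{j-1}$ with $i<j$ two successive occurrences of $u$ in $x$; $\mathcal{R}_{x,u}$ is the set of return words to $u$. For a word $w$, $V(w)\in\mathbb{Z}^d$ is its Parikh vector: the entry of index $c\in A$ is the number of occurrences of $c$ in $w$. -}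

module Defs where

open import Data.Nat using (ℕ; zero; suc; _+_; _*_; _∸_; _<_; _≤_)
open import Data.Fin using (Fin; zero; suc; _≟_)
open import Data.List using (List; []; _∷_; map; upTo; concatMap; length)
open import Data.Integer as ℤ using (ℤ; +_)
open import Data.Product using (Σ; ∃; ∃-syntax; _×_; _,_; proj₁; proj₂)
open import Data.List.Relation.Unary.All using (All)
open import Relation.Binary.PropositionalEquality using (_≡_)
open import Relation.Nullary using (¬_)

Word : ℕ → Set
Word d = List (Fin d)

Subst : ℕ → Set
Subst d = Fin d → Word d

apply : ∀ {d} → Subst d → Word d → Word d
apply σ = concatMap σ

iter : ∀ {d} → Subst d → ℕ → Word d → Word d
iter σ zero    w = w
iter σ (suc n) w = apply σ (iter σ n w)

Mat : ℕ → Set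
Mat d = Fin d → Fin d → ℕ

sumFin : ∀ {d} → (Fin d → ℕ) → ℕ
sumFin {zero}  f = 0
sumFin {suc d} f = f zero + sumFin (λ i → f (suc i))

_⊗_ : ∀ {d} → Mat d → Mat d → Mat d
(M ⊗ N) i j = sumFin (λ k → M i k * N k j)

idMat : ∀ {d} → Mat d
idMat i j with i ≟ j
... | Relation.Nullary.yes _ = 1
... | Relation.Nullary.no  _ = 0

matPow : ∀ {d} → Mat d → ℕ → Mat d
matPow M zero    = idMat
matPow M (suc k) = M ⊗ matPow M k

occ : ∀ {d} → Fin d → Word d → ℕ
occ c [] = 0
occ c (b ∷ w) with c ≟ b
... | Relation.Nullary.yes _ = suc (occ c w)
... | Relation.Nullary.no  _ = occ c w

sumℤ : List ℤ → ℤ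
sumℤ [] = + 0
sumℤ (z ∷ zs) = z ℤ.+ sumℤ zs

NonEmptyWord : ∀ {d} → Word d → Set
NonEmptyWord w = ∃[ b ] ∃[ v ] w ≡ b ∷ v

incidence : ∀ {d} → Subst d → Mat d
incidence σ i j = occ i (σ j)

Primitive : ∀ {d} → Subst d → Set
Primitive σ = ∃[ k ] (∀ i j → 0 < matPow (incidence σ) (suc k) i j)

Prolongable : ∀ {d} → Subst d → Fin d → Set
Prolongable σ a =
  (∃[ b ] ∃[ w ] σ a ≡ a ∷ b ∷ w)
  × (∀ N → ∃[ n ] N ≤ length (iter σ n (a ∷ [])))

Seq : ℕ → Set
Seq d = ℕ → Fin d

factor : ∀ {d} → Seq d → ℕ → ℕ → Word d
factor x i m = map (λ k → x (i + k)) (upTo m)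

-- x = σ^ω(a): every σ^n(a) is a prefix of x
-- (this determines x uniquely since |σ^n(a)| → ∞)
IsFixedPointLimit : ∀ {d} → Subst d → Fin d → Seq d → Set
IsFixedPointLimit σ a x =
  ∀ n → iter σ n (a ∷ []) ≡ factor x 0 (length (iter σ n (a ∷ [])))

OccursAt : ∀ {d} → Seq d → Word d → ℕ → Set
OccursAt x u i = factor x i (length u) ≡ u

ReturnWord : ∀ {d} → Seq d → Word d → Word d → Set
ReturnWord x u w =
  ∃[ i ] ∃[ j ] (i < j × OccursAt x u i × OccursAt x u j
                 × (∀ k → i < k → k < j → ¬ OccursAt x u k)
                 × w ≡ factor x i (j ∸ i))

Parikh : ∀ {d} → Word d → Fin d → ℤ
Parikh w c = + occ c w

-- {V(w) : w ∈ R_{x,u}} generates ℤ^d as an abelian group: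
-- every v ∈ ℤ^d is a finite ℤ-linear combination of Parikh vectors of return words
ParikhGenerates : ∀ {d} → Seq d → Word d → Set
ParikhGenerates {d} x u =
  ∀ (v : Fin d → ℤ) →
    ∃[ cs ] (All (λ p → ReturnWord x u (proj₂ p)) cs
             × (∀ c → v c ≡ sumℤ (map (λ p → proj₁ p ℤ.* Parikh (proj₂ p) c) cs)))

-- The length gap c ↦ |σ(c)| − |τ(c)| is a linear functional on ℤ^d which, paired with V(w), gives
-- |σ(w)| − |τ(w)|. By (1) it vanishes on the Parikh vectors of return words, hence by (2) on all of
-- ℤ^d, so |σ(c)| = |τ(c)| for every letter c. Every letter occurs in some return word (otherwise the
-- unit vector at c would not be generated), and if σ and τ have equal letter lengths then σ(w) = τ(w)
-- forces σ(c) = τ(c) for each letter c of w.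
module Submission where

open import Defs
open import Data.Nat using (ℕ)
open import Data.Fin using (Fin)
open import Relation.Binary.PropositionalEquality using (_≡_)

import Data.Nat as ℕ
import Data.Nat.Properties as ℕ
open import Data.Fin using (zero; suc; _≟_)
import Data.Fin.Properties as Fin
open import Data.Integer as ℤ using (ℤ; +_; _+_; _-_; _*_)
import Data.Integer.Properties as ℤ
open import Data.Integer.Tactic.RingSolver using (solve-∀)
open import Data.List using (List; []; _∷_; _++_; [_]; length; map)
import Data.List.Properties as List
open import Data.List.Membership.Propositional using (_∈_; _∉_)
open import Data.List.Relation.Unary.Any using (here; there; any?)
open import Data.List.Relation.Unary.All using (All; []; _∷_)
open import Data.Product using (∃-syntax; _×_; _,_; proj₁; proj₂)
open import Data.Empty using (⊥-elim)
open import Function using (_∘_)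
open import Relation.Binary.PropositionalEquality using (refl; sym; trans; cong; cong₂; module ≡-Reasoning)
open import Relation.Nullary using (yes; no; ¬_)
open import Algebra.Properties.Semiring.Sum ℤ.+-*-semiring
  using (sum; ∑-distrib-+; *-distribˡ-sum; sum-cong-≗; sum-replicate-zero)

open ≡-Reasoning

private
  variable
    d : ℕ

occ-∷ : (c b : Fin d) (w : Word d) → occ c (b ∷ w) ≡ occ c [ b ] ℕ.+ occ c w
occ-∷ c b w with c ≟ b
... | yes _ = refl
... | no  _ = refl

occ-suc : (c b : Fin d) → occ (suc c) [ suc b ] ≡ occ c [ b ]
occ-suc c b with suc c ≟ suc b | c ≟ b
... | yes _  | yes _  = refl
... | yes eq | no neq = ⊥-elim (neq (Fin.suc-injective eq))
... | no neq | yes eq = ⊥-elim (neq (cong suc eq))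
... | no _   | no _   = refl

occ-self : (c : Fin d) → occ c [ c ] ≡ 1
occ-self c with c ≟ c
... | yes _  = refl
... | no neq = ⊥-elim (neq refl)

occ-∉ : (c : Fin d) (w : Word d) → c ∉ w → occ c w ≡ 0
occ-∉ c []      c∉w = refl
occ-∉ c (b ∷ w) c∉w with c ≟ b
... | yes c≡b = ⊥-elim (c∉w (here c≡b))
... | no  _   = occ-∉ c w (c∉w ∘ there)

⟨_,_⟩ : (Fin d → ℤ) → (Fin d → ℤ) → ℤ
⟨ v , g ⟩ = sum (λ c → v c * g c)

⟨⟩-zero : (g : Fin d → ℤ) → ⟨ (λ _ → + 0) , g ⟩ ≡ + 0
⟨⟩-zero {d} g = trans (sum-cong-≗ (ℤ.*-zeroˡ ∘ g)) (sum-replicate-zero d)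

⟨⟩-+ : (v w g : Fin d → ℤ) → ⟨ (λ c → v c + w c) , g ⟩ ≡ ⟨ v , g ⟩ + ⟨ w , g ⟩
⟨⟩-+ v w g = trans (sum-cong-≗ (λ c → ℤ.*-distribʳ-+ (g c) (v c) (w c)))
                   (∑-distrib-+ (λ c → v c * g c) (λ c → w c * g c))

⟨⟩-* : (k : ℤ) (v g : Fin d → ℤ) → ⟨ (λ c → k * v c) , g ⟩ ≡ k * ⟨ v , g ⟩
⟨⟩-* k v g = trans (sum-cong-≗ (λ c → ℤ.*-assoc k (v c) (g c)))
                   (sym (*-distribˡ-sum k (λ c → v c * g c)))

⟨Parikh-letter⟩ : (b : Fin d) (g : Fin d → ℤ) → ⟨ Parikh [ b ] , g ⟩ ≡ g b
⟨Parikh-letter⟩ zero    g = begin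
  + 1 * g zero + ⟨ (λ _ → + 0) , g ∘ suc ⟩  ≡⟨ cong₂ _+_ (ℤ.*-identityˡ (g zero)) (⟨⟩-zero (g ∘ suc)) ⟩
  g zero + + 0                              ≡⟨ ℤ.+-identityʳ (g zero) ⟩
  g zero                                    ∎
⟨Parikh-letter⟩ (suc b) g = begin
  + 0 * g zero + ⟨ (λ c → + occ (suc c) [ suc b ]) , g ∘ suc ⟩
    ≡⟨ cong (_+_ (+ 0 * g zero)) (sum-cong-≗ (λ c → cong (λ n → + n * g (suc c)) (occ-suc c b))) ⟩
  + 0 + ⟨ Parikh [ b ] , g ∘ suc ⟩
    ≡⟨ ℤ.+-identityˡ _ ⟩
  ⟨ Parikh [ b ] , g ∘ suc ⟩
    ≡⟨ ⟨Parikh-letter⟩ b (g ∘ suc) ⟩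
  g (suc b) ∎

weight : (Fin d → ℤ) → Word d → ℤ
weight g w = sumℤ (map g w)

⟨Parikh⟩≡weight : (w : Word d) (g : Fin d → ℤ) → ⟨ Parikh w , g ⟩ ≡ weight g w
⟨Parikh⟩≡weight []      g = ⟨⟩-zero g
⟨Parikh⟩≡weight (b ∷ w) g = begin
  ⟨ Parikh (b ∷ w) , g ⟩
    ≡⟨ sum-cong-≗ (λ c → cong (λ n → + n * g c) (occ-∷ c b w)) ⟩
  ⟨ (λ c → Parikh [ b ] c + Parikh w c) , g ⟩
    ≡⟨ ⟨⟩-+ (Parikh [ b ]) (Parikh w) g ⟩
  ⟨ Parikh [ b ] , g ⟩ + ⟨ Parikh w , g ⟩
    ≡⟨ cong₂ _+_ (⟨Parikh-letter⟩ b g) (⟨Parikh⟩≡weight w g) ⟩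
  g b + weight g w ∎

weight-distrib-- : (g h : Fin d → ℤ) (w : Word d) → weight (λ c → g c - h c) w ≡ weight g w - weight h w
weight-distrib-- g h []      = refl
weight-distrib-- g h (b ∷ w) = trans (cong (_+_ (g b - h b)) (weight-distrib-- g h w))
                             (interchange (g b) (h b) (weight g w) (weight h w))
  where
  interchange : ∀ p q r s → (p - q) + (r - s) ≡ (p + r) - (q + s)
  interchange = solve-∀

length-apply : (σ : Subst d) (w : Word d) → + length (apply σ w) ≡ weight (λ c → + length (σ c)) w
length-apply σ []      = refl
length-apply σ (b ∷ w) = trans (cong +_ (List.length-++ (σ b))) (cong (_+_ (+ length (σ b))) (length-apply σ w))

combination : List (ℤ × Word d) → Fin d → ℤ
combination cs c = sumℤ (map (λ p → proj₁ p * Parikh (proj₂ p) c) cs)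

Spans : (Word d → Set) → Set
Spans {d} P = ∀ (v : Fin d → ℤ) → ∃[ cs ] (All (P ∘ proj₂) cs × (∀ c → v c ≡ combination cs c))

⟨combination⟩≡0 : {P : Word d → Set} (g : Fin d → ℤ) → (∀ w → P w → weight g w ≡ + 0) →
                  (cs : List (ℤ × Word d)) → All (P ∘ proj₂) cs → ⟨ combination cs , g ⟩ ≡ + 0
⟨combination⟩≡0 g vanish []             []         = ⟨⟩-zero g
⟨combination⟩≡0 g vanish ((k , w) ∷ cs) (Pw ∷ Pcs) = begin
  ⟨ combination ((k , w) ∷ cs) , g ⟩
    ≡⟨ ⟨⟩-+ (λ c → k * Parikh w c) (combination cs) g ⟩
  ⟨ (λ c → k * Parikh w c) , g ⟩ + ⟨ combination cs , g ⟩
    ≡⟨ cong₂ _+_ (⟨⟩-* k (Parikh w) g) (⟨combination⟩≡0 g vanish cs Pcs) ⟩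
  k * ⟨ Parikh w , g ⟩ + + 0
    ≡⟨ cong (λ z → k * z + + 0) (trans (⟨Parikh⟩≡weight w g) (vanish w Pw)) ⟩
  k * + 0 + + 0
    ≡⟨ cong (_+ + 0) (ℤ.*-zeroʳ k) ⟩
  + 0 ∎

spanning-weight-annihilator : {P : Word d → Set} → Spans P → (g : Fin d → ℤ) →
                              (∀ w → P w → weight g w ≡ + 0) → ∀ b → g b ≡ + 0
spanning-weight-annihilator spans g vanish b with spans (Parikh [ b ])
... | cs , Pcs , eq = begin
  g b                     ≡⟨ sym (⟨Parikh-letter⟩ b g) ⟩
  ⟨ Parikh [ b ] , g ⟩    ≡⟨ sum-cong-≗ (λ c → cong (_* g c) (eq c)) ⟩
  ⟨ combination cs , g ⟩  ≡⟨ ⟨combination⟩≡0 g vanish cs Pcs ⟩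
  + 0                     ∎

occurs-in-combination : {P : Word d → Set} (c : Fin d) (cs : List (ℤ × Word d)) → All (P ∘ proj₂) cs →
                        ¬ combination cs c ≡ + 0 → ∃[ w ] (P w × c ∈ w)
occurs-in-combination c []             []         nonzero = ⊥-elim (nonzero refl)
occurs-in-combination c ((k , w) ∷ cs) (Pw ∷ Pcs) nonzero with any? (c ≟_) w
... | yes c∈w = w , Pw , c∈w
... | no  c∉w = occurs-in-combination c cs Pcs λ rest≡0 → nonzero (begin
  k * + occ c w + combination cs c  ≡⟨ cong (λ n → k * + n + combination cs c) (occ-∉ c w c∉w) ⟩
  k * + 0 + combination cs c        ≡⟨ cong (_+ combination cs c) (ℤ.*-zeroʳ k) ⟩
  + 0 + combination cs c            ≡⟨ ℤ.+-identityˡ _ ⟩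
  combination cs c                  ≡⟨ rest≡0 ⟩
  + 0                               ∎)

spanning-covers : {P : Word d → Set} → Spans P → ∀ c → ∃[ w ] (P w × c ∈ w)
spanning-covers spans c with spans (Parikh [ c ])
... | cs , Pcs , eq = occurs-in-combination c cs Pcs λ comb≡0 →
  ℕ.1+n≢0 (ℤ.+-injective (trans (cong +_ (sym (occ-self c))) (trans (eq c) comb≡0)))

++-cancel-equal-length : {A : Set} (xs ys zs ws : List A) → length xs ≡ length zs →
                         xs ++ ys ≡ zs ++ ws → xs ≡ zs × ys ≡ ws
++-cancel-equal-length []       ys []       ws _   eq = refl , eq
++-cancel-equal-length (x ∷ xs) ys (z ∷ zs) ws len eq with List.∷-injective eq
... | refl , eq′ with ++-cancel-equal-length xs ys zs ws (ℕ.suc-injective len) eq′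
...   | refl , ys≡ws = refl , ys≡ws

apply-≡⇒letters-≡ : (σ τ : Subst d) → (∀ c → length (σ c) ≡ length (τ c)) →
                    ∀ w → apply σ w ≡ apply τ w → ∀ {c} → c ∈ w → σ c ≡ τ c
apply-≡⇒letters-≡ σ τ len (b ∷ w) eq c∈w
  with ++-cancel-equal-length (σ b) (apply σ w) (τ b) (apply τ w) (len b) eq
... | σb≡τb , rest = case c∈w
  where
  case : ∀ {c} → c ∈ b ∷ w → σ c ≡ τ c
  case (here refl) = σb≡τb
  case (there c∈w) = apply-≡⇒letters-≡ σ τ len w rest c∈w

agreeing-on-spanning-set⇒≡ : {P : Word d → Set} → Spans P → (σ τ : Subst d) →
                             (∀ w → P w → apply σ w ≡ apply τ w) → ∀ c → σ c ≡ τ c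
agreeing-on-spanning-set⇒≡ {P = P} spans σ τ agree c with spanning-covers spans c
... | w , Pw , c∈w = apply-≡⇒letters-≡ σ τ equal-lengths w (agree w Pw) c∈w
  where
  lengthGap : Fin _ → ℤ
  lengthGap b = + length (σ b) - + length (τ b)

  gap-vanishes : ∀ w → P w → weight lengthGap w ≡ + 0
  gap-vanishes w Pw = begin
    weight lengthGap w
      ≡⟨ weight-distrib-- _ _ w ⟩
    weight (λ b → + length (σ b)) w - weight (λ b → + length (τ b)) w
      ≡⟨ sym (cong₂ _-_ (length-apply σ w) (length-apply τ w)) ⟩
    + length (apply σ w) - + length (apply τ w)
      ≡⟨ cong (λ v → + length v - + length (apply τ w)) (agree w Pw) ⟩
    + length (apply τ w) - + length (apply τ w)
      ≡⟨ ℤ.+-inverseʳ (+ length (apply τ w)) ⟩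
    + 0 ∎

  equal-lengths : ∀ b → length (σ b) ≡ length (τ b)
  equal-lengths b =
    ℤ.+-injective (ℤ.i-j≡0⇒i≡j _ _ (spanning-weight-annihilator spans lengthGap gap-vanishes b))

lemma4p2 : (d : ℕ) (σ τ : Subst d) (a : Fin d) (x y : Seq d) (u : Word d) →
    Primitive σ → Primitive τ →
    Prolongable σ a → Prolongable τ a →
    IsFixedPointLimit σ a x → IsFixedPointLimit τ a y →
    NonEmptyWord u → OccursAt x u 0 → OccursAt y u 0 →
    (∀ w → ReturnWord x u w → apply σ w ≡ apply τ w) →
    ParikhGenerates x u →
    ∀ c → σ c ≡ τ c
lemma4p2 d σ τ a x y u _ _ _ _ _ _ _ _ _ agree generates =
  agreeing-on-spanning-set⇒≡ generates σ τ agree
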